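{- Let $\sigma$ be a linear extension of $\preceq$ and let $y=(r,k)$ be a bounding state satisfying invariants (I1) and (I2) that bounds $\sigma$. For $i\in\{1,\dots,n-1\}$ and $c\in\{0,1\}$ define $c'=1-c$ if $\sigma(i)=r(i+1)$ and $c'=c$ otherwise. Then for all $i\in\{1,\dots,n-1\}$ and $c\in\{0,1\}$, the permutation $A(\sigma,i,c')$ is bounded by the bounding state $B(y,i,c)$.
   Context: Let $n\ge 2$ and let $\preceq$ be a partial order on $[n]=\{1,\dots,n\}$ such that the identity permutation is a linear extension (i.e. $a\preceq b$ implies $a\le b$). A permutation $\sigma$ has $\sigma(i)$ the item in position $i$; it is a linear extension if for all $i<j$, $\neg(\sigma(j)\preceq\sigma(i))$. Adjacent transposition step $A(\sigma,i,c)$: if $c=1$ and $\neg(\sigma(i)\preceq\sigma(i+1))$, swap the entries in positions $i,i+1$; return the result. Let $*$ be a new symbol. A bounding state is a pair $(r,k)$ with $k\in[n]$ and $r\in(\{*\}\cup[n])^n$ whose numeric entries are distinct and at most $k$ (items $1,\dots,k$ are active). $(r,k)$ bounds $\sigma$ if for every $a\le k$ and all positions $i,j$: $\sigma(i)=a$ and $r(j)=a$ imply $i\le j$. Invariants: (I1) every $a\le k$ appears in $r$; (I2) if $r(i)=a\le k$, $r(j)=b\le k$, $a\ne b$, $a\preceq b$, then $i<j$. Bounding step $B((r,k),i,c)$: (1) if $c=1$ and it is not the case that $r(i),r(i+1)\in[n]$ with $r(i)\preceq r(i+1)$ (comparisons involving $*$ are false), exchange $r(i),r(i+1)$; (2)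 if then $r(n)=*$, set $r(n)\leftarrow k+1$, $k\leftarrow k+1$; return $(r,k)$. -}

module Defs where

open import Data.Nat as ℕ using (ℕ; suc; _∸_)
import Data.Nat.Properties as ℕP
open import Data.Fin as F using (Fin; toℕ; fromℕ<)
open import Data.Fin.Properties using () renaming (_≟_ to _≟F_)
open import Data.Fin.Permutation using (Permutation′; _⟨$⟩ʳ_; _∘ₚ_; transpose)
open import Data.Maybe using (Maybe; just; nothing)
open import Data.Maybe.Properties using (≡-dec)
open import Data.Bool using (Bool; true; false; if_then_else_; not; _∧_)
open import Data.Product using (_×_; ∃)
open import Relation.Binary using (Rel; Decidable)
open import Relation.Binary.PropositionalEquality using (_≡_; _≢_)
open import Relation.Nullary using (¬_; does)
open import Level using (0ℓ)

-- Conventions (0-based): items [n] = {1..n} are represented by Fin n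
-- (item a+1 ↔ a : Fin n); positions 1..n likewise by Fin n.
-- The symbol * is `nothing`; a numeric entry a is `just a`.
-- An adjacent-transposition index i ∈ {1,…,n-1} is represented by the
-- 0-based position p : ℕ with suc p < n (positions p and p+1).
-- The bit c ∈ {0,1} is a Bool (true = 1).
-- "Item a is active" (a ≤ k in 1-based terms) is  toℕ a < k.

posL : ∀ {n} (p : ℕ) → suc p ℕ.< n → Fin n
posL p h = fromℕ< (ℕP.<⇒≤ h)

posR : ∀ {n} (p : ℕ) → suc p ℕ.< n → Fin n
posR p h = fromℕ< h

lastPos : ∀ {n} → 1 ℕ.≤ n → Fin n
lastPos {suc m} _ = F.fromℕ m

swapAt : ∀ {n} {A : Set} → Fin n → Fin n → (Fin n → A) → (Fin n → A)
swapAt i j r x = if does (x ≟F i) then r j else (if does (x ≟F j) then r i else r x)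

setAt : ∀ {n} {A : Set} → Fin n → A → (Fin n → A) → (Fin n → A)
setAt i v r x = if does (x ≟F i) then v else r x

Word : ℕ → Set
Word n = Fin n → Maybe (Fin n)

record BState (n : ℕ) : Set where
  constructor ⟨_,_⟩
  field
    r : Word n
    k : ℕ
open BState public

IsBoundingState : ∀ {n} → BState n → Set
IsBoundingState {n} y =
  (1 ℕ.≤ k y × k y ℕ.≤ n)
  × (∀ (i j : Fin n) (a : Fin n) → r y i ≡ just a → r y j ≡ just a → i ≡ j)
  × (∀ (i : Fin n) (a : Fin n) → r y i ≡ just a → toℕ a ℕ.< k y)

Bounds : ∀ {n} → BState n → Permutation′ n → Set
Bounds {n} y σ = ∀ (a : Fin n) → toℕ a ℕ.< k y → ∀ (i j : Fin n) →
  σ ⟨$⟩ʳ i ≡ a → r y j ≡ just a → i F.≤ j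

I1 : ∀ {n} → BState n → Set
I1 {n} y = ∀ (a : Fin n) → toℕ a ℕ.< k y → ∃ λ j → r y j ≡ just a

module _ {n : ℕ} (_≼_ : Rel (Fin n) 0ℓ) (_≼?_ : Decidable _≼_) where

  IdLinExt : Set
  IdLinExt = ∀ {a b} → a ≼ b → toℕ a ℕ.≤ toℕ b

  -- σ ⟨$⟩ʳ i is the item in position i
  IsLinearExtension : Permutation′ n → Set
  IsLinearExtension σ = ∀ (i j : Fin n) → i F.< j → ¬ ((σ ⟨$⟩ʳ j) ≼ (σ ⟨$⟩ʳ i))

  I2 : BState n → Set
  I2 y = ∀ (i j a b : Fin n) → r y i ≡ just a → r y j ≡ just b →
    toℕ a ℕ.< k y → toℕ b ℕ.< k y → a ≢ b → a ≼ b → i F.< j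

  Astep : Permutation′ n → (p : ℕ) → suc p ℕ.< n → Bool → Permutation′ n
  Astep σ p h c =
    if c ∧ not (does ((σ ⟨$⟩ʳ posL p h) ≼? (σ ⟨$⟩ʳ posR p h)))
    then transpose (posL p h) (posR p h) ∘ₚ σ
    else σ

  numLeq : Maybe (Fin n) → Maybe (Fin n) → Bool
  numLeq (just a) (just b) = does (a ≼? b)
  numLeq _ _ = false

  Bstep1 : BState n → (p : ℕ) → suc p ℕ.< n → Bool → BState n
  Bstep1 ⟨ r , k ⟩ p h c =
    if c ∧ not (numLeq (r (posL p h)) (r (posR p h)))
    then ⟨ swapAt (posL p h) (posR p h) r , k ⟩
    else ⟨ r , k ⟩

  -- part (2): if r(n) = * then r(n) ← k+1, k ← k+1.
  -- (In 0-based items, item k+1 is fromℕ< (k < n); the case k = n with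
  --  r(n) = * cannot occur under (I1) and is left unchanged.)
  Bstep2 : 1 ℕ.≤ n → BState n → BState n
  Bstep2 h1 ⟨ r , k ⟩ with r (lastPos h1) | k ℕ.<? n
  ... | nothing | Relation.Nullary.yes k<n = ⟨ setAt (lastPos h1) (just (fromℕ< k<n)) r , suc k ⟩
  ... | _ | _ = ⟨ r , k ⟩

  Bstep : BState n → (p : ℕ) → suc p ℕ.< n → Bool → BState n
  Bstep y p h c = Bstep2 (ℕP.≤-<-trans ℕ.z≤n h) (Bstep1 y p h c)

  cPrime : Permutation′ n → BState n → (p : ℕ) → suc p ℕ.< n → Bool → Bool
  cPrime σ y p h c =
    if does (≡-dec _≟F_ (r y (posR p h)) (just (σ ⟨$⟩ʳ posL p h))) then not c else c

{-# OPTIONS --safe #-}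
-- Each step either leaves its argument alone or reindexes it by the transposition τ of the
-- positions i, i+1: A acts on the positions of σ, B on those of r.  Reindexing one or both sides
-- by τ preserves the order of two positions except that i+1 may move before i, so "position
-- in σ ≤ position in r" survives for every active item unless one specific coincidence occurs:
-- r(i+1) = σ(i+1) if only r moves, r(i) = σ(i) if only σ moves, r(i+1) = σ(i) if both move.
-- The coupling c′ (flip exactly when r(i+1) = σ(i)) avoids these: distinctness of the entries
-- of r and injectivity of σ handle most cases, (I1)+(I2) the case σ(i) ⪯ σ(i+1) with r(i) ⋠ r(i+1),
-- and σ being a linear extension the case σ(i) ⋠ σ(i+1) with r(i) ⪯ r(i+1).  Part (2) of B only
-- writes the new item k+1 into the last position, which dominates every position.
module Submission where

open import Defs
open import Data.Nat using (ℕ; suc; _≤_; _<_)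
open import Data.Fin using (Fin)
open import Data.Fin.Permutation using (Permutation′)
open import Data.Bool using (Bool)
open import Relation.Binary using (Rel; Decidable; IsPartialOrder)
open import Relation.Binary.PropositionalEquality using (_≡_)
open import Level using (0ℓ)

open import Data.Nat using (_<?_)
import Data.Nat.Properties as ℕP
open import Data.Fin as F using (toℕ; fromℕ<)
open import Data.Fin.Properties using () renaming (_≟_ to _≟F_)
import Data.Fin.Properties as FP
open import Data.Fin.Permutation using (_⟨$⟩ʳ_; _⟨$⟩ˡ_; _∘ₚ_; transpose; inverseʳ)
open import Data.Maybe using (just; nothing)
open import Data.Maybe.Properties using (≡-dec; just-injective)
open import Data.Bool using (true; false; not; _∧_)
open import Data.Product using (_×_; _,_; ∃₂; proj₁; proj₂)
open import Data.Sum as Sum using (_⊎_; inj₁; inj₂)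
open import Function using (_∘_)
open import Function.Bundles using (Injection)
open import Function.Properties.Inverse using (↔⇒↣)
open import Relation.Nullary using (yes; no; does; contradiction)
open import Relation.Nullary.Decidable using (dec-true; dec-false)
open import Relation.Binary.PropositionalEquality
  using (refl; sym; trans; cong; subst; _≢_; module ≡-Reasoning)

permutation-injective : ∀ {n} (π : Permutation′ n) {i j : Fin n} → π ⟨$⟩ʳ i ≡ π ⟨$⟩ʳ j → i ≡ j
permutation-injective π = Injection.injective (↔⇒↣ π)

swapAt≗transpose : ∀ {n} {A : Set} (i j : Fin n) (r : Fin n → A) x →
                   swapAt i j r x ≡ r (transpose i j ⟨$⟩ʳ x)
swapAt≗transpose i j r x with does (x ≟F i)
... | true = refl
... | false with does (x ≟F j)
...   | true = refl
...   | false = refl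

≤-lastPos : ∀ {n} (1≤n : 1 ≤ n) (i : Fin n) → i F.≤ lastPos 1≤n
≤-lastPos {suc _} _ = FP.≤fromℕ

EntriesActive : ∀ {n} → BState n → Set
EntriesActive {n} y = ∀ (j a : Fin n) → r y j ≡ just a → toℕ a < k y

bounds-reindex : ∀ {n} {σ σ′ : Permutation′ n} {r r′ : Word n} {k : ℕ} {L R : Fin n}
  (π ρ : Fin n → Fin n) →
  (∀ i → σ′ ⟨$⟩ʳ i ≡ σ ⟨$⟩ʳ π i) → (∀ j → r′ j ≡ r (ρ j)) →
  (∀ i j → π i F.≤ ρ j → i F.≤ j ⊎ (i ≡ R × j ≡ L)) →
  r (ρ L) ≢ just (σ ⟨$⟩ʳ π R) →
  Bounds ⟨ r , k ⟩ σ → Bounds ⟨ r′ , k ⟩ σ′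
bounds-reindex {σ = σ} {σ′} {r} {r′} {L = L} {R} π ρ σ′≗σ∘π r′≗r∘ρ monotone exception bnd
               a act i j σ′i≡a r′j≡a
  with monotone i j (bnd a act (π i) (ρ j) (trans (sym (σ′≗σ∘π i)) σ′i≡a)
                                           (trans (sym (r′≗r∘ρ j)) r′j≡a))
... | inj₁ i≤j = i≤j
... | inj₂ (refl , refl) = contradiction (begin
  r (ρ L)           ≡⟨ sym (r′≗r∘ρ L) ⟩
  r′ L              ≡⟨ r′j≡a ⟩
  just a            ≡⟨ cong just (sym σ′i≡a) ⟩
  just (σ′ ⟨$⟩ʳ R)  ≡⟨ cong just (σ′≗σ∘π R) ⟩
  just (σ ⟨$⟩ʳ π R) ∎) exception
  where open ≡-Reasoning

module AdjacentPositions {n} {L R : Fin n} (R≡1+L : toℕ R ≡ suc (toℕ L)) where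

  L<R : L F.< R
  L<R = ℕP.≤-reflexive (sym R≡1+L)

  L≢R : L ≢ R
  L≢R = FP.<⇒≢ L<R

  <R⇒≤L : ∀ {i : Fin n} → i F.< R → i F.≤ L
  <R⇒≤L {i} i<R = ℕP.≤-pred (subst (suc (toℕ i) ≤_) R≡1+L i<R)

  L<⇒R≤ : ∀ {j : Fin n} → L F.< j → R F.≤ j
  L<⇒R≤ {j} = subst (_≤ toℕ j) (sym R≡1+L)

  ≤R⇒≤L⊎≡R : ∀ {i : Fin n} → i F.≤ R → i F.≤ L ⊎ i ≡ R
  ≤R⇒≤L⊎≡R {i} i≤R with i ≟F R
  ... | yes i≡R = inj₂ i≡R
  ... | no i≢R = inj₁ (<R⇒≤L (ℕP.≤∧≢⇒< i≤R (i≢R ∘ FP.toℕ-injective)))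

  L≤⇒≡L⊎R≤ : ∀ {j : Fin n} → L F.≤ j → j ≡ L ⊎ R F.≤ j
  L≤⇒≡L⊎R≤ {j} L≤j with j ≟F L
  ... | yes j≡L = inj₁ j≡L
  ... | no j≢L = inj₂ (L<⇒R≤ (ℕP.≤∧≢⇒< L≤j (j≢L ∘ sym ∘ FP.toℕ-injective)))

  between-adjacent : ∀ {x : Fin n} → L F.≤ x → x F.≤ R → x ≡ L ⊎ x ≡ R
  between-adjacent L≤x = Sum.map₁ (λ x≤L → FP.≤-antisym x≤L L≤x) ∘ ≤R⇒≤L⊎≡R

  τ : Permutation′ n
  τ = transpose L R

  τL≡R : τ ⟨$⟩ʳ L ≡ R
  τL≡R rewrite dec-true (L ≟F L) refl = refl

  τR≡L : τ ⟨$⟩ʳ R ≡ L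
  τR≡L rewrite dec-false (R ≟F L) (L≢R ∘ sym) | dec-true (R ≟F R) refl = refl

  τ-fixes : ∀ {x : Fin n} → x ≢ L → x ≢ R → τ ⟨$⟩ʳ x ≡ x
  τ-fixes {x} x≢L x≢R rewrite dec-false (x ≟F L) x≢L | dec-false (x ≟F R) x≢R = refl

  -- A view: matching on x ≟F L directly would also abstract it inside τ ⟨$⟩ʳ x.
  data Site (x : Fin n) : Set where
    left  : x ≡ L → Site x
    right : x ≡ R → Site x
    other : x ≢ L → x ≢ R → Site x

  site : ∀ x → Site x
  site x with x ≟F L | x ≟F R
  ... | yes x≡L | _ = left x≡L
  ... | no _ | yes x≡R = right x≡R
  ... | no x≢L | no x≢R = other x≢L x≢R

  ≤τ⇒≤ : ∀ {i j : Fin n} → i F.≤ τ ⟨$⟩ʳ j → i F.≤ j ⊎ (i ≡ R × j ≡ L)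
  ≤τ⇒≤ {i} {j} i≤τj with site j
  ... | left refl = Sum.map₂ (_, refl) (≤R⇒≤L⊎≡R (subst (i F.≤_) τL≡R i≤τj))
  ... | right refl = inj₁ (FP.≤-trans (subst (i F.≤_) τR≡L i≤τj) (ℕP.<⇒≤ L<R))
  ... | other j≢L j≢R = inj₁ (subst (i F.≤_) (τ-fixes j≢L j≢R) i≤τj)

  τ≤⇒≤ : ∀ {i j : Fin n} → τ ⟨$⟩ʳ i F.≤ j → i F.≤ j ⊎ (i ≡ R × j ≡ L)
  τ≤⇒≤ {i} {j} τi≤j with site i
  ... | left refl = inj₁ (FP.≤-trans (ℕP.<⇒≤ L<R) (subst (F._≤ j) τL≡R τi≤j))
  ... | right refl = Sum.swap (Sum.map₁ (refl ,_) (L≤⇒≡L⊎R≤ (subst (F._≤ j) τR≡L τi≤j)))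
  ... | other i≢L i≢R = inj₁ (subst (F._≤ j) (τ-fixes i≢L i≢R) τi≤j)

  τ≤τ⇒≤ : ∀ {i j : Fin n} → τ ⟨$⟩ʳ i F.≤ τ ⟨$⟩ʳ j → i F.≤ j ⊎ (i ≡ R × j ≡ L)
  τ≤τ⇒≤ τi≤τj with ≤τ⇒≤ τi≤τj
  ... | inj₁ τi≤j = τ≤⇒≤ τi≤j
  ... | inj₂ (τi≡R , refl) = inj₁ (FP.≤-reflexive (permutation-injective τ (trans τi≡R (sym τL≡R))))

  module _ {σ : Permutation′ n} {r : Word n} {k : ℕ} where

    bounds-swapAt : r R ≢ just (σ ⟨$⟩ʳ R) →
                    Bounds ⟨ r , k ⟩ σ → Bounds ⟨ swapAt L R r , k ⟩ σ
    bounds-swapAt rR≢σR =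
      bounds-reindex {σ = σ} {σ′ = σ} (λ x → x) (τ ⟨$⟩ʳ_) (λ _ → refl) (swapAt≗transpose L R r)
        (λ _ _ → ≤τ⇒≤) (rR≢σR ∘ trans (cong r (sym τL≡R)))

    bounds-transpose : r L ≢ just (σ ⟨$⟩ʳ L) →
                       Bounds ⟨ r , k ⟩ σ → Bounds ⟨ r , k ⟩ (τ ∘ₚ σ)
    bounds-transpose rL≢σL =
      bounds-reindex {σ = σ} {σ′ = τ ∘ₚ σ} (τ ⟨$⟩ʳ_) (λ x → x) (λ _ → refl) (λ _ → refl)
        (λ _ _ → τ≤⇒≤) (λ e → rL≢σL (trans e (cong (just ∘ (σ ⟨$⟩ʳ_)) τR≡L)))

    bounds-swapAt-transpose : r R ≢ just (σ ⟨$⟩ʳ L) →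
                              Bounds ⟨ r , k ⟩ σ → Bounds ⟨ swapAt L R r , k ⟩ (τ ∘ₚ σ)
    bounds-swapAt-transpose rR≢σL =
      bounds-reindex {σ = σ} {σ′ = τ ∘ₚ σ} (τ ⟨$⟩ʳ_) (τ ⟨$⟩ʳ_) (λ _ → refl) (swapAt≗transpose L R r)
        (λ _ _ → τ≤τ⇒≤)
        (λ e → rR≢σL (trans (cong r (sym τL≡R)) (trans e (cong (just ∘ (σ ⟨$⟩ʳ_)) τR≡L))))

module _ {n : ℕ} (_≼_ : Rel (Fin n) 0ℓ) (_≼?_ : Decidable _≼_) where

  numLeq-just : ∀ {u v a b} → u ≡ just a → v ≡ just b → a ≼ b → numLeq _≼_ _≼?_ u v ≡ true
  numLeq-just refl refl = dec-true (_ ≼? _)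

  numLeq≡true⇒ : ∀ u v → numLeq _≼_ _≼?_ u v ≡ true → ∃₂ λ a b → u ≡ just a × v ≡ just b × a ≼ b
  numLeq≡true⇒ (just a) (just b) eq with a ≼? b
  ... | yes a≼b = a , b , refl , refl , a≼b
  numLeq≡true⇒ (just a) nothing ()
  numLeq≡true⇒ nothing _ ()

  linearExtension-≼⇒≤ : ∀ {σ : Permutation′ n} → IsLinearExtension _≼_ _≼?_ σ →
                        ∀ {i j : Fin n} → (σ ⟨$⟩ʳ i) ≼ (σ ⟨$⟩ʳ j) → i F.≤ j
  linearExtension-≼⇒≤ lin {i} {j} σi≼σj = ℕP.≮⇒≥ (λ j<i → lin j i j<i σi≼σj)

  bounds-Bstep2 : ∀ {y : BState n} {σ : Permutation′ n} (1≤n : 1 ≤ n) →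
                  EntriesActive y → Bounds y σ → Bounds (Bstep2 _≼_ _≼?_ 1≤n y) σ
  bounds-Bstep2 {y} {σ} 1≤n active bnd with r y (lastPos 1≤n) | k y <? n
  ... | nothing | yes k<n = bounds-extended
    where
    bounds-extended : Bounds ⟨ setAt (lastPos 1≤n) (just (fromℕ< k<n)) (r y) , suc (k y) ⟩ σ
    bounds-extended a _ i j σi≡a rj≡a with j ≟F lastPos 1≤n
    ... | yes refl = ≤-lastPos 1≤n i
    ... | no _ = bnd a (active j a rj≡a) i j σi≡a rj≡a
  ... | nothing | no _ = bnd
  ... | just _ | _ = bnd

  module Window (p : ℕ) (h : suc p < n) where

    L R : Fin n
    L = posL p h
    R = posR p h

    R≡1+L : toℕ R ≡ suc (toℕ L)
    R≡1+L = trans (FP.toℕ-fromℕ< h) (cong suc (sym (FP.toℕ-fromℕ< _)))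

    open AdjacentPositions R≡1+L

    entriesActive-Bstep1 : ∀ {y : BState n} → EntriesActive y →
                           ∀ c → EntriesActive (Bstep1 _≼_ _≼?_ y p h c)
    entriesActive-Bstep1 {y} active c with c ∧ not (numLeq _≼_ _≼?_ (r y L) (r y R))
    ... | true = λ j a rj≡a →
      active (τ ⟨$⟩ʳ j) a (trans (sym (swapAt≗transpose L R (r y) j)) rj≡a)
    ... | false = active

    module _ {σ : Permutation′ n} {y : BState n} (active : EntriesActive y) (bnd : Bounds y σ) where

      r[R]≡σR⇒r[L]≡σL : IdLinExt _≼_ _≼?_ → I1 y → I2 _≼_ _≼?_ y →
                        (σ ⟨$⟩ʳ L) ≼ (σ ⟨$⟩ʳ R) → r y R ≡ just (σ ⟨$⟩ʳ R) → r y L ≡ just (σ ⟨$⟩ʳ L)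
      r[R]≡σR⇒r[L]≡σL idLin i1 i2 σL≼σR rR≡σR = subst (λ x → r y x ≡ just (σ ⟨$⟩ʳ L)) j≡L rj≡σL
        where
        σR-active = active R _ rR≡σR
        σL-active = ℕP.≤-<-trans (idLin σL≼σR) σR-active
        j = proj₁ (i1 _ σL-active)
        rj≡σL = proj₂ (i1 _ σL-active)
        j<R : j F.< R
        j<R = i2 j R _ _ rj≡σL rR≡σR σL-active σR-active (L≢R ∘ permutation-injective σ) σL≼σR
        j≡L : j ≡ L
        j≡L = FP.≤-antisym (<R⇒≤L j<R) (bnd _ σL-active L j refl rj≡σL)

      σL≼r[R]⇒r[R]≡σL⊎σR : IsLinearExtension _≼_ _≼?_ σ →
                           ∀ {f} → r y R ≡ just f → (σ ⟨$⟩ʳ L) ≼ f → f ≡ σ ⟨$⟩ʳ L ⊎ f ≡ σ ⟨$⟩ʳ R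
      σL≼r[R]⇒r[R]≡σL⊎σR lin {f} rR≡f σL≼f =
        Sum.map (f≡σ ∘ cong (σ ⟨$⟩ʳ_)) (f≡σ ∘ cong (σ ⟨$⟩ʳ_)) (between-adjacent L≤x x≤R)
        where
        x = σ ⟨$⟩ˡ f
        σx≡f : σ ⟨$⟩ʳ x ≡ f
        σx≡f = inverseʳ σ
        f≡σ : ∀ {z} → σ ⟨$⟩ʳ x ≡ z → f ≡ z
        f≡σ = trans (sym σx≡f)
        L≤x : L F.≤ x
        L≤x = linearExtension-≼⇒≤ {σ = σ} lin (subst ((σ ⟨$⟩ʳ L) ≼_) (sym σx≡f) σL≼f)
        x≤R : x F.≤ R
        x≤R = bnd f (active R f rR≡f) x R σx≡f rR≡f

      bounds-Bstep1 : IdLinExt _≼_ _≼?_ → IsLinearExtension _≼_ _≼?_ σ →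
        (∀ (i j a : Fin n) → r y i ≡ just a → r y j ≡ just a → i ≡ j) → I1 y → I2 _≼_ _≼?_ y →
        ∀ c → Bounds (Bstep1 _≼_ _≼?_ y p h c) (Astep _≼_ _≼?_ σ p h (cPrime _≼_ _≼?_ σ y p h c))
      bounds-Bstep1 idLin lin distinct i1 i2 false with ≡-dec _≟F_ (r y R) (just (σ ⟨$⟩ʳ L))
      ... | no _ = bnd
      ... | yes rR≡σL with (σ ⟨$⟩ʳ L) ≼? (σ ⟨$⟩ʳ R)
      ...   | yes _ = bnd
      ...   | no _ = bounds-transpose {σ = σ} (λ rL≡σL → L≢R (distinct L R _ rL≡σL rR≡σL)) bnd
      bounds-Bstep1 idLin lin distinct i1 i2 true with ≡-dec _≟F_ (r y R) (just (σ ⟨$⟩ʳ L))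
      ... | yes rR≡σL with numLeq _≼_ _≼?_ (r y L) (r y R)
      ...   | true = bnd
      ...   | false = bounds-swapAt {σ = σ}
        (λ rR≡σR → L≢R (permutation-injective σ (just-injective (trans (sym rR≡σL) rR≡σR)))) bnd
      bounds-Bstep1 idLin lin distinct i1 i2 true | no rR≢σL
        with (σ ⟨$⟩ʳ L) ≼? (σ ⟨$⟩ʳ R) | numLeq _≼_ _≼?_ (r y L) (r y R) in numLeq-eq
      ... | yes _ | true = bnd
      ... | yes σL≼σR | false = bounds-swapAt {σ = σ} rR≢σR bnd
        where
        rR≢σR : r y R ≢ just (σ ⟨$⟩ʳ R)
        rR≢σR rR≡σR with trans (sym numLeq-eq)
          (numLeq-just (r[R]≡σR⇒r[L]≡σL idLin i1 i2 σL≼σR rR≡σR) rR≡σR σL≼σR)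
        ... | ()
      ... | no _ | false = bounds-swapAt-transpose {σ = σ} rR≢σL bnd
      ... | no σL⋠σR | true = bounds-transpose {σ = σ} rL≢σL bnd
        where
        rL≢σL : r y L ≢ just (σ ⟨$⟩ʳ L)
        rL≢σL rL≡σL with numLeq≡true⇒ (r y L) (r y R) numLeq-eq
        ... | a , f , rL≡a , rR≡f , a≼f with just-injective (trans (sym rL≡a) rL≡σL)
        ... | refl with σL≼r[R]⇒r[R]≡σL⊎σR lin rR≡f a≼f
        ... | inj₁ f≡σL = rR≢σL (trans rR≡f (cong just f≡σL))
        ... | inj₂ f≡σR = σL⋠σR (subst (a ≼_) f≡σR a≼f)

theorem2 : (n : ℕ) → 2 ≤ n →
    (_≼_ : Rel (Fin n) 0ℓ) → IsPartialOrder _≡_ _≼_ → (_≼?_ : Decidable _≼_) →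
    IdLinExt _≼_ _≼?_ →
    (σ : Permutation′ n) → IsLinearExtension _≼_ _≼?_ σ →
    (y : BState n) → IsBoundingState y → I1 y → I2 _≼_ _≼?_ y → Bounds y σ →
    (p : ℕ) (h : suc p < n) (c : Bool) →
    Bounds (Bstep _≼_ _≼?_ y p h c) (Astep _≼_ _≼?_ σ p h (cPrime _≼_ _≼?_ σ y p h c))
theorem2 n _ _≼_ _ _≼?_ idLin σ lin y (_ , distinct , active) i1 i2 bnd p h c =
  bounds-Bstep2 _≼_ _≼?_ {σ = Astep _≼_ _≼?_ σ p h (cPrime _≼_ _≼?_ σ y p h c)} _
    (entriesActive-Bstep1 active c)
    (bounds-Bstep1 active bnd idLin lin distinct i1 i2 c)
  where open Window _≼_ _≼?_ p h
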